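{- Let $\mathcal J_k$ be one of the color classes produced by AlgoFor-DDP-NS (described in the context) and let $m_k$ be the number of drones the greedy procedure uses for $\mathcal J_k$. Then $$cost(\mathcal J_k)\ \ge\ (m_k-1)(B-\epsilon'_kB)+\epsilon_{min}B,$$ where $cost(\mathcal J_k)=\sum_{I_j\in\mathcal J_k}cost(I_j)$, $\epsilon_k=\frac1B\max_{I_j\in\mathcal J_k}cost(I_j)$, $\epsilon'_k=\min\{\frac12,\epsilon_k\}$ and $\epsilon_{min}=\frac1B\min_{1\le j\le n}cost(I_j)$.
   Context: Instance of DDP-NS: $n$ deliveries with closed delivery time intervals $I_j=[t_j^L,t_j^R]$ and costs $cost(I_j)\in(0,B]$, $B>0$ the battery capacity of identical drones; two intervals conflict if they intersect. $\omega$ is the maximum number of pairwise conflicting intervals. AlgoFor-DDP-NS: build the interval graph $G$ on the delivery intervals (adjacent iff conflicting); properly color $G$ with $\omega$ colors (classes $\mathcal J_1,\dots,\mathcal J_\omega$); for each class $\mathcal J_k$ separately run the greedy procedure: process the intervals of $\mathcal J_k$ one by one in arbitrary order; assign $I_j$ to some drone already used for $\mathcal J_k$ whose remaining capacity is at least $cost(I_j)$ if one exists (its remaining capacity decreases by $cost(I_j)$), otherwise use a new drone for $I_j$ with remaining capacity $B-cost(I_j)$.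
   Formalization: The endpoints of the delivery intervals, the costs $cost(I_j)$ and the battery capacity $B$ are rational rather than real. -}

module Defs where

open import Data.Nat using (ℕ)
open import Data.Fin using (Fin; _≟_)
open import Data.Integer using (+_)
open import Data.Rational using (ℚ; _≤_; _<_; _-_; _+_; _*_; _⊔_; _⊓_; _/_; 0ℚ; 1ℚ; ½)
open import Data.List using (List; []; _∷_; _++_; [_]; length; lookup; filter; map; foldr; sum)
open import Data.List.Base using (_[_]∷=_; allFin)
open import Data.List.Relation.Unary.All using (All)
open import Data.List.Relation.Unary.AllPairs using (AllPairs)
open import Data.List.Relation.Unary.Unique.Propositional using (Unique)
open import Data.Product using (_×_; Σ)
open import Relation.Binary.PropositionalEquality using (_≡_; _≢_)

ℕtoℚ : ℕ → ℚ
ℕtoℚ m = + m / 1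

module _ {n : ℕ} (L R : Fin n → ℚ) where

  Conflict : Fin n → Fin n → Set
  Conflict i j = (L i ≤ R j) × (L j ≤ R i)

  IsClique : List (Fin n) → Set
  IsClique xs = Unique xs × AllPairs Conflict xs

  IsCliqueNumber : ℕ → Set
  IsCliqueNumber ω =
    Σ (List (Fin n)) (λ xs → IsClique xs × length xs ≡ ω)
    × (∀ xs → IsClique xs → Data.Nat._≤_ (length xs) ω)

  ProperColoring : {ω : ℕ} → (Fin n → Fin ω) → Set
  ProperColoring col = ∀ i j → i ≢ j → Conflict i j → col i ≢ col j

colorClass : {n ω : ℕ} → (Fin n → Fin ω) → Fin ω → List (Fin n)
colorClass {n} col k = filter (λ j → col j ≟ k) (allFin n)

-- One greedy step: the state is the list of remaining capacities of the
-- drones used so far for the class; x is the cost of the current interval.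
data Step (B : ℚ) : List ℚ → ℚ → List ℚ → Set where
  use : ∀ {ds x} (i : Fin (length ds)) → x ≤ lookup ds i →
        Step B ds x (ds [ i ]∷= (lookup ds i - x))
  new : ∀ {ds x} → All (λ r → r < x) ds → Step B ds x (ds ++ [ B - x ])

-- A complete run of the greedy procedure on a sequence of costs
-- (every admissible choice of drone is allowed).
data Run (B : ℚ) : List ℚ → List ℚ → List ℚ → Set where
  done : ∀ {ds} → Run B ds [] ds
  step : ∀ {ds x xs ds' ds''} → Step B ds x ds' → Run B ds' xs ds'' →
         Run B ds (x ∷ xs) ds''

sumℚ : List ℚ → ℚ
sumℚ = foldr _+_ 0ℚ

-- A greedy run conserves capacity: the costs of the class sum to m B minus the residual capacities
-- of its m drones. Every residual is at most B - c₀ (c₀ the least cost), and at most one exceeds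
-- e = min(B/2, C) (C the largest cost of the class): a new drone is opened for a cost x only when
-- all residuals are below x, so either x ≤ B/2 and the older residuals are below e, or x > B/2
-- and the new residual B - x is. Hence the residuals sum to at most (B - c₀) + (m - 1) e.
module Submission where

open import Defs
open import Data.Nat using (ℕ; suc)
import Data.Nat.Properties as ℕ
import Data.Nat.Coprimality as Coprimality
import Data.Integer as ℤ
import Data.Integer.Properties as ℤ
open import Data.Fin using (Fin; zero; suc)
open import Data.Rational using (ℚ; mkℚ; _/_; _≤_; _<_; _+_; _-_; _*_; -_; _⊔_; _⊓_; 0ℚ; 1ℚ; ½)
open import Data.Rational.Properties
open import Data.Rational.Solver using (module +-*-Solver)
open import Data.List using (List; []; _∷_; _++_; [_]; length; lookup; map; foldr; allFin)
open import Data.List.Base using (_[_]∷=_)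
open import Data.List.Properties using (length-++; length-∷=)
open import Data.List.Relation.Unary.All as All using (All; []; _∷_)
import Data.List.Relation.Unary.All.Properties as All
open import Data.List.Relation.Unary.Any using (here; there)
open import Data.List.Relation.Binary.Pointwise as Pointwise using (Pointwise; []; _∷_)
open import Data.List.Membership.Propositional using (_∈_)
open import Data.List.Membership.Propositional.Properties using (∈-map⁺; ∈-allFin)
open import Data.List.Relation.Binary.Permutation.Propositional using (_↭_; ↭-sym; ↭⇒↭ₛ)
open import Data.List.Relation.Binary.Permutation.Propositional.Properties using (↭-empty-inv; ∈-resp-↭; map⁺)
import Data.List.Relation.Binary.Permutation.Setoid.Properties as PermutationSetoid
open import Data.Product using (_×_; _,_; proj₁; proj₂)
open import Relation.Nullary using (¬_; yes; no)
open import Relation.Binary.PropositionalEquality using (_≡_; refl; sym; trans; cong; cong₂; setoid; module ≡-Reasoning)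

open +-*-Solver

ℕtoℚ-suc : ∀ m → ℕtoℚ (suc m) ≡ 1ℚ + ℕtoℚ m
ℕtoℚ-suc m = begin
  -- the middle term computes to (1ℤ ℤ.+ ℤ.+ m ℤ.* ℤ.+ 1) / 1
  (ℤ.1ℤ ℤ.+ ℤ.+ m) / 1       ≡⟨ cong (λ z → (ℤ.1ℤ ℤ.+ z) / 1) (sym (ℤ.*-identityʳ (ℤ.+ m))) ⟩
  1ℚ + mkℚ (ℤ.+ m) 0 coprime ≡⟨ cong (λ q → 1ℚ + q) (sym (normalize-coprime coprime)) ⟩
  1ℚ + ℕtoℚ m                 ∎
  where
  open ≡-Reasoning
  coprime : Coprimality.Coprime m 1
  coprime = Coprimality.sym (Coprimality.1-coprimeTo m)

foldr-⊔-upperBound : ∀ {x} xs z → x ∈ xs → x ≤ foldr _⊔_ z xs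
foldr-⊔-upperBound (y ∷ ys) z (here refl) = p≤p⊔q y _
foldr-⊔-upperBound (y ∷ ys) z (there x∈ys) = ≤-trans (foldr-⊔-upperBound ys z x∈ys) (p≤q⊔p y _)

foldr-⊓-lowerBound : ∀ {x} xs z → x ∈ xs → foldr _⊓_ z xs ≤ x
foldr-⊓-lowerBound (y ∷ ys) z (here refl) = p⊓q≤p y _
foldr-⊓-lowerBound (y ∷ ys) z (there x∈ys) = ≤-trans (p⊓q≤q y _) (foldr-⊓-lowerBound ys z x∈ys)

foldr-⊓-≤-init : ∀ xs z → foldr _⊓_ z xs ≤ z
foldr-⊓-≤-init [] z = ≤-refl
foldr-⊓-≤-init (y ∷ ys) z = ≤-trans (p⊓q≤q y _) (foldr-⊓-≤-init ys z)

sumℚ-↭ : ∀ {xs ys} → xs ↭ ys → sumℚ xs ≡ sumℚ ys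
sumℚ-↭ xs↭ys = PermutationSetoid.foldr-commMonoid (setoid ℚ) +-0-isCommutativeMonoid (↭⇒↭ₛ xs↭ys)

sumℚ-++-[] : ∀ xs y → sumℚ (xs ++ [ y ]) ≡ sumℚ xs + y
sumℚ-++-[] [] y = trans (+-identityʳ y) (sym (+-identityˡ y))
sumℚ-++-[] (x ∷ xs) y = trans (cong (x +_) (sumℚ-++-[] xs y)) (sym (+-assoc x _ y))

sumℚ-∷=-decrease : ∀ xs (i : Fin (length xs)) d → sumℚ (xs [ i ]∷= (lookup xs i - d)) ≡ sumℚ xs - d
sumℚ-∷=-decrease (x ∷ xs) zero d = solve 3 (λ x d s → (x :- d) :+ s := (x :+ s) :- d) refl x d (sumℚ xs)
sumℚ-∷=-decrease (x ∷ xs) (suc i) d = trans (cong (x +_) (sumℚ-∷=-decrease xs i d)) (sym (+-assoc x _ (- d)))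

sumℚ-≤-length* : ∀ {e rs} → All (_≤ e) rs → sumℚ rs ≤ ℕtoℚ (length rs) * e
sumℚ-≤-length* {e} [] = ≤-reflexive (sym (*-zeroˡ e))
sumℚ-≤-length* {e} {r ∷ rs} (r≤e ∷ rs≤e) = ≤-trans (+-mono-≤ r≤e (sumℚ-≤-length* rs≤e)) (≤-reflexive (begin
  e + ℕtoℚ (length rs) * e    ≡⟨ solve 2 (λ e n → e :+ n :* e := (con 1ℚ :+ n) :* e) refl e (ℕtoℚ (length rs)) ⟩
  (1ℚ + ℕtoℚ (length rs)) * e ≡⟨ cong (_* e) (sym (ℕtoℚ-suc (length rs))) ⟩
  ℕtoℚ (suc (length rs)) * e  ∎))
  where open ≡-Reasoning

load : ℚ → List ℚ → ℚ
load B ds = ℕtoℚ (length ds) * B - sumℚ ds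

length-++-[] : ∀ (xs : List ℚ) y → length (xs ++ [ y ]) ≡ suc (length xs)
length-++-[] xs y = trans (length-++ xs) (ℕ.+-comm (length xs) 1)

load-step : ∀ {B ds x ds'} → Step B ds x ds' → load B ds' ≡ load B ds + x
load-step {B} {ds} {x} (use i _) = begin
  ℕtoℚ (length (ds [ i ]∷= (lookup ds i - x))) * B - sumℚ (ds [ i ]∷= (lookup ds i - x))
    ≡⟨ cong₂ (λ n s → ℕtoℚ n * B - s) (length-∷= ds i _) (sumℚ-∷=-decrease ds i x) ⟩
  ℕtoℚ (length ds) * B - (sumℚ ds - x)
    ≡⟨ solve 3 (λ c s x → c :- (s :- x) := (c :- s) :+ x) refl (ℕtoℚ (length ds) * B) (sumℚ ds) x ⟩
  load B ds + x ∎
  where open ≡-Reasoning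
load-step {B} {ds} {x} (new _) = begin
  ℕtoℚ (length (ds ++ [ B - x ])) * B - sumℚ (ds ++ [ B - x ])
    ≡⟨ cong₂ (λ n s → ℕtoℚ n * B - s) (length-++-[] ds (B - x)) (sumℚ-++-[] ds (B - x)) ⟩
  ℕtoℚ (suc (length ds)) * B - (sumℚ ds + (B - x))
    ≡⟨ cong (λ n → n * B - (sumℚ ds + (B - x))) (ℕtoℚ-suc (length ds)) ⟩
  (1ℚ + ℕtoℚ (length ds)) * B - (sumℚ ds + (B - x))
    ≡⟨ solve 4 (λ n B s x → (con 1ℚ :+ n) :* B :- (s :+ (B :- x)) := (n :* B :- s) :+ x) refl (ℕtoℚ (length ds)) B (sumℚ ds) x ⟩
  load B ds + x ∎
  where open ≡-Reasoning

load-run : ∀ {B ds xs ds'} → Run B ds xs ds' → load B ds' ≡ load B ds + sumℚ xs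
load-run {B} {ds} done = sym (+-identityʳ (load B ds))
load-run {B} {ds} {x ∷ xs} {ds''} (step {ds' = ds'} s r) = begin
  load B ds''                ≡⟨ load-run r ⟩
  load B ds' + sumℚ xs       ≡⟨ cong (_+ sumℚ xs) (load-step s) ⟩
  load B ds + x + sumℚ xs    ≡⟨ +-assoc (load B ds) x (sumℚ xs) ⟩
  load B ds + sumℚ (x ∷ xs)  ∎
  where open ≡-Reasoning

¬Run-∷-[] : ∀ {B d ds xs} → ¬ Run B (d ∷ ds) xs []
¬Run-∷-[] (step (use zero _) r) = ¬Run-∷-[] r
¬Run-∷-[] (step (use (suc i) _) r) = ¬Run-∷-[] r
¬Run-∷-[] (step (new _) r) = ¬Run-∷-[] r

Run-[]-[] : ∀ {B xs} → Run B [] xs [] → xs ≡ []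
Run-[]-[] done = refl
Run-[]-[] (step (use () _) _)
Run-[]-[] (step (new []) r) with () ← ¬Run-∷-[] r

minus-antimonoʳ-≤ : ∀ p {q r} → q ≤ r → p - r ≤ p - q
minus-antimonoʳ-≤ p q≤r = +-monoʳ-≤ p (neg-antimono-≤ q≤r)

p-q≤p : ∀ p {q} → 0ℚ ≤ q → p - q ≤ p
p-q≤p p 0≤q = ≤-trans (minus-antimonoʳ-≤ p 0≤q) (≤-reflexive (+-identityʳ p))

∷=-decreasing : ∀ xs (i : Fin (length xs)) {v} → v ≤ lookup xs i → Pointwise _≤_ (xs [ i ]∷= v) xs
∷=-decreasing (x ∷ xs) zero v≤x = v≤x ∷ Pointwise.refl ≤-refl
∷=-decreasing (x ∷ xs) (suc i) v≤ = ≤-refl ∷ ∷=-decreasing xs i v≤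

All-≤-antimono : ∀ {a xs ys} → Pointwise _≤_ xs ys → All (_≤ a) ys → All (_≤ a) xs
All-≤-antimono [] [] = []
All-≤-antimono (x≤y ∷ xs≤ys) (y≤a ∷ ys≤a) = ≤-trans x≤y y≤a ∷ All-≤-antimono xs≤ys ys≤a

data AtMostOneAbove (e : ℚ) : List ℚ → Set where
  []         : AtMostOneAbove e []
  _∷_        : ∀ {r rs} → r ≤ e → AtMostOneAbove e rs → AtMostOneAbove e (r ∷ rs)
  rest-below : ∀ {r rs} → All (_≤ e) rs → AtMostOneAbove e (r ∷ rs)

AtMostOneAbove-antimono : ∀ {e xs ys} → Pointwise _≤_ xs ys → AtMostOneAbove e ys → AtMostOneAbove e xs
AtMostOneAbove-antimono [] [] = []
AtMostOneAbove-antimono (x≤y ∷ xs≤ys) (y≤e ∷ ys) = ≤-trans x≤y y≤e ∷ AtMostOneAbove-antimono xs≤ys ys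
AtMostOneAbove-antimono (_ ∷ xs≤ys) (rest-below ys≤e) = rest-below (All-≤-antimono xs≤ys ys≤e)

AtMostOneAbove-++-[] : ∀ {e xs} → All (_≤ e) xs → ∀ y → AtMostOneAbove e (xs ++ [ y ])
AtMostOneAbove-++-[] [] y = rest-below []
AtMostOneAbove-++-[] (x≤e ∷ xs≤e) y = x≤e ∷ AtMostOneAbove-++-[] xs≤e y

AtMostOneAbove-++-[]-below : ∀ {e xs y} → AtMostOneAbove e xs → y ≤ e → AtMostOneAbove e (xs ++ [ y ])
AtMostOneAbove-++-[]-below [] y≤e = y≤e ∷ []
AtMostOneAbove-++-[]-below (x≤e ∷ xs) y≤e = x≤e ∷ AtMostOneAbove-++-[]-below xs y≤e
AtMostOneAbove-++-[]-below (rest-below xs≤e) y≤e = rest-below (All.++⁺ xs≤e (y≤e ∷ []))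

sumℚ-AtMostOneAbove : ∀ {a e r rs} → All (_≤ a) (r ∷ rs) → AtMostOneAbove e (r ∷ rs) →
                      sumℚ (r ∷ rs) ≤ a + ℕtoℚ (length rs) * e
sumℚ-AtMostOneAbove (r≤a ∷ _) (rest-below rs≤e) = +-mono-≤ r≤a (sumℚ-≤-length* rs≤e)
sumℚ-AtMostOneAbove {e = e} (r≤a ∷ _) (_ ∷ []) = +-mono-≤ r≤a (≤-reflexive (sym (*-zeroˡ e)))
sumℚ-AtMostOneAbove {a} {e} {r} {r′ ∷ rs} (_ ∷ rs≤a) (r≤e ∷ amo) = begin
  r + sumℚ (r′ ∷ rs)                       ≤⟨ +-mono-≤ r≤e (sumℚ-AtMostOneAbove rs≤a amo) ⟩
  e + (a + ℕtoℚ (length rs) * e)           ≡⟨ solve 3 (λ a n e → e :+ (a :+ n :* e) := a :+ (con 1ℚ :+ n) :* e) refl a (ℕtoℚ (length rs)) e ⟩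
  a + (1ℚ + ℕtoℚ (length rs)) * e          ≡⟨ cong (λ n → a + n * e) (sym (ℕtoℚ-suc (length rs))) ⟩
  a + ℕtoℚ (suc (length rs)) * e           ∎
  where open ≤-Reasoning

module GreedyResiduals (B c₀ C : ℚ) where

  e : ℚ
  e = ½ * B ⊓ C

  Admissible : ℚ → Set
  Admissible x = c₀ ≤ x × x ≤ C × 0ℚ ≤ x

  Residuals : List ℚ → Set
  Residuals rs = All (_≤ B - c₀) rs × AtMostOneAbove e rs

  B-x≤e : ∀ {x} → ½ * B < x → x ≤ C → B - x ≤ e
  B-x≤e {x} ½B<x x≤C = ⊓-glb B-x≤½B (≤-trans B-x≤½B (≤-trans (<⇒≤ ½B<x) x≤C))
    where
    B-x≤½B : B - x ≤ ½ * B
    B-x≤½B = ≤-trans (minus-antimonoʳ-≤ B (<⇒≤ ½B<x))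
               (≤-reflexive (solve 1 (λ B → B :- con ½ :* B := con ½ :* B) refl B))

  step-Residuals : ∀ {ds x ds'} → Step B ds x ds' → Admissible x → Residuals ds → Residuals ds'
  step-Residuals {ds} {x} (use i _) (_ , _ , 0≤x) (ds≤a , ds-amo) =
    All-≤-antimono decreasing ds≤a , AtMostOneAbove-antimono decreasing ds-amo
    where
    decreasing : Pointwise _≤_ (ds [ i ]∷= (lookup ds i - x)) ds
    decreasing = ∷=-decreasing ds i (p-q≤p (lookup ds i) 0≤x)
  step-Residuals {ds} {x} (new ds<x) (c₀≤x , x≤C , _) (ds≤a , ds-amo) =
    All.++⁺ ds≤a (minus-antimonoʳ-≤ B c₀≤x ∷ []) , new-amo
    where
    new-amo : AtMostOneAbove e (ds ++ [ B - x ])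
    new-amo with x ≤? ½ * B
    ... | yes x≤½B = AtMostOneAbove-++-[] (All.map (λ r<x → ≤-trans (<⇒≤ r<x) (⊓-glb x≤½B x≤C)) ds<x) (B - x)
    ... | no x≰½B = AtMostOneAbove-++-[]-below ds-amo (B-x≤e (≰⇒> x≰½B) x≤C)

  run-Residuals : ∀ {ds xs ds'} → Run B ds xs ds' → All Admissible xs → Residuals ds → Residuals ds'
  run-Residuals done _ rs = rs
  run-Residuals (step s r) (x-ok ∷ xs-ok) rs = run-Residuals r xs-ok (step-Residuals s x-ok rs)

  greedy-cost-bound : ∀ {xs r rs} → Run B [] xs (r ∷ rs) → All Admissible xs →
                      ℕtoℚ (length rs) * (B - e) + c₀ ≤ sumℚ xs
  greedy-cost-bound {xs} {r} {rs} run xs-ok = begin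
    N * (B - e) + c₀                 ≡⟨ solve 4 (λ N B e c₀ → N :* (B :- e) :+ c₀ := (con 1ℚ :+ N) :* B :- ((B :- c₀) :+ N :* e)) refl N B e c₀ ⟩
    (1ℚ + N) * B - (B - c₀ + N * e)  ≤⟨ minus-antimonoʳ-≤ ((1ℚ + N) * B) (sumℚ-AtMostOneAbove rs≤a rs-amo) ⟩
    (1ℚ + N) * B - sumℚ (r ∷ rs)     ≡⟨ cong (λ m → m * B - sumℚ (r ∷ rs)) (sym (ℕtoℚ-suc (length rs))) ⟩
    load B (r ∷ rs)                  ≡⟨ load-run run ⟩
    load B [] + sumℚ xs              ≡⟨ cong (_+ sumℚ xs) (solve 1 (λ B → con 0ℚ :* B :- con 0ℚ := con 0ℚ) refl B) ⟩
    0ℚ + sumℚ xs                     ≡⟨ +-identityˡ (sumℚ xs) ⟩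
    sumℚ xs                          ∎
    where
    open ≤-Reasoning
    N : ℚ
    N = ℕtoℚ (length rs)
    rs≤a : All (_≤ B - c₀) (r ∷ rs)
    rs≤a = proj₁ (run-Residuals run xs-ok ([] , []))
    rs-amo : AtMostOneAbove e (r ∷ rs)
    rs-amo = proj₂ (run-Residuals run xs-ok ([] , []))

empty-class-bound : ∀ B c₀ → 0ℚ < B → c₀ ≤ B → (0ℚ - 1ℚ) * (B - ½ * B ⊓ 0ℚ) + c₀ ≤ 0ℚ
empty-class-bound B c₀ 0<B c₀≤B = begin
  (0ℚ - 1ℚ) * (B - ½ * B ⊓ 0ℚ) + c₀ ≡⟨ cong (λ m → (0ℚ - 1ℚ) * (B - m) + c₀) (p≥q⇒p⊓q≡q 0≤½B) ⟩
  (0ℚ - 1ℚ) * (B - 0ℚ) + c₀          ≡⟨ solve 2 (λ B c₀ → (con 0ℚ :- con 1ℚ) :* (B :- con 0ℚ) :+ c₀ := c₀ :- B) refl B c₀ ⟩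
  c₀ - B                             ≤⟨ +-monoˡ-≤ (- B) c₀≤B ⟩
  B - B                              ≡⟨ +-inverseʳ B ⟩
  0ℚ                                 ∎
  where
  open ≤-Reasoning
  0≤½B : 0ℚ ≤ ½ * B
  0≤½B = *-monoˡ-≤-nonNeg ½ (<⇒≤ 0<B)

lemma1 : (n ω : ℕ) (L R cost : Fin n → ℚ) (B : ℚ) → 0ℚ < B →
         (∀ j → L j ≤ R j) →
         (∀ j → (0ℚ < cost j) × (cost j ≤ B)) →
         IsCliqueNumber L R ω →
         (col : Fin n → Fin ω) → ProperColoring L R col →
         (k : Fin ω) (order : List (Fin n)) → order ↭ colorClass col k →
         (ds : List ℚ) → Run B [] (map cost order) ds →
         (ℕtoℚ (length ds) - 1ℚ)
             * (B - (½ * B) ⊓ foldr _⊔_ 0ℚ (map cost (colorClass col k)))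
           + foldr _⊓_ B (map cost (allFin n))
           ≤ sumℚ (map cost (colorClass col k))
lemma1 n ω L R cost B _ _ _ _ col _ k (_ ∷ _) _ [] run with () ← Run-[]-[] run
lemma1 n ω L R cost B 0<B _ _ _ col _ k [] []↭class [] _
  rewrite ↭-empty-inv (↭-sym []↭class) = empty-class-bound B _ 0<B (foldr-⊓-≤-init (map cost (allFin n)) B)
lemma1 n ω L R cost B _ _ cost-bounds _ col _ k order order↭class (_ ∷ ds) run = begin
  (ℕtoℚ (suc (length ds)) - 1ℚ) * (B - e) + c₀  ≡⟨ cong (λ m → (m - 1ℚ) * (B - e) + c₀) (ℕtoℚ-suc (length ds)) ⟩
  ((1ℚ + N) - 1ℚ) * (B - e) + c₀                ≡⟨ solve 3 (λ N E c₀ → ((con 1ℚ :+ N) :- con 1ℚ) :* E :+ c₀ := N :* E :+ c₀) refl N (B - e) c₀ ⟩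
  N * (B - e) + c₀                              ≤⟨ greedy-cost-bound run (All.map⁺ (All.tabulate admissible)) ⟩
  sumℚ (map cost order)                         ≡⟨ sumℚ-↭ (map⁺ cost order↭class) ⟩
  sumℚ (map cost class)                         ∎
  where
  open ≤-Reasoning
  class : List (Fin n)
  class = colorClass col k
  c₀ : ℚ
  c₀ = foldr _⊓_ B (map cost (allFin n))
  open GreedyResiduals B c₀ (foldr _⊔_ 0ℚ (map cost class))
  N : ℚ
  N = ℕtoℚ (length ds)
  admissible : ∀ {j} → j ∈ order → Admissible (cost j)
  admissible {j} j∈order =
    foldr-⊓-lowerBound (map cost (allFin n)) B (∈-map⁺ cost (∈-allFin j)) ,
    foldr-⊔-upperBound (map cost class) 0ℚ (∈-map⁺ cost (∈-resp-↭ order↭class j∈order)) ,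
    <⇒≤ (proj₁ (cost-bounds j))
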